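{- Let $G,H$ be graphs with $H\leq_R G$ and let $\Phi\in\hom_R(G,H)$. Then $\Phi$ is synchronizing if and only if for every $I\in V(H)$ there exists $u\in L_I(H)$ with $|(\partial\Phi)^{ -1}(I)\cdot u|=1$.
   Context: All graphs are finite directed graphs with state set $V(G)$, edge set $E(G)$, source/target maps $s,t$; loops and parallel edges allowed; all graphs sink-free. $E_I(G)=s^{ -1}(I)$, $L(G)$ finite edge paths, $L_I(G)$ those starting at $I$. A homomorphism consists of maps on edges and ($\partial\Phi$) on states commuting with $s,t$. A right-resolver is a surjective homomorphism with $\Phi|_{E_I(G)}:E_I(G)\to E_{\partial\Phi(I)}(H)$ bijective for all $I$; $\hom_R(G,H)$, $H\leq_R G$ if nonempty. For $I\in V(G)$ and $u\in L_{\partial\Phi(I)}(H)$, $I\cdot u$ is the endpoint of the unique $\gamma\in L_I(G)$ with $\Phi(\gamma)=u$; for a set $U$ of states in one fiber, $U\cdot u=\{I\cdot u: I\in U\}$. Stability: $I_1\sim_\Phi I_2$ iff $\partial\Phi(I_1)=\partial\Phi(I_2)=:I$ and for every $u\in L_I(H)$ there is $v\in L_{t(u)}(H)$ with $I_1\cdot uv=I_2\cdot uv$. $\Phi$ is synchronizing if each fiber $(\partial\Phi)^{ -1}(I)$, $I\in V(H)$, is a single $\sim_\Phi$ class. -}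

module Defs where

open import Data.Nat using (ℕ)
open import Data.Fin using (Fin)
open import Data.Product using (Σ; ∃; ∃-syntax; _×_; _,_)
open import Relation.Binary.PropositionalEquality using (_≡_)

record Graph : Set where
  field
    nV : ℕ
    nE : ℕ
    s  : Fin nE → Fin nV
    t  : Fin nE → Fin nV
    sinkFree : (I : Fin nV) → ∃[ e ] s e ≡ I

open Graph public

V : Graph → Set
V G = Fin (nV G)

E : Graph → Set
E G = Fin (nE G)

data Path (G : Graph) : V G → V G → Set where
  nil  : (I : V G) → Path G I I
  cons : (e : E G) {J : V G} → Path G (t G e) J → Path G (s G e) J

_++ₚ_ : {G : Graph} {I J K : V G} → Path G I J → Path G J K → Path G I K
nil _ ++ₚ v = v
cons e γ ++ₚ v = cons e (γ ++ₚ v)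

record Hom (G H : Graph) : Set where
  field
    φ  : E G → E H
    ∂φ : V G → V H
    s-comm : (e : E G) → s H (φ e) ≡ ∂φ (s G e)
    t-comm : (e : E G) → t H (φ e) ≡ ∂φ (t G e)

open Hom public

record IsRightResolver {G H : Graph} (Φ : Hom G H) : Set where
  field
    surjE : (f : E H) → ∃[ e ] φ Φ e ≡ f
    surjV : (I : V H) → ∃[ J ] ∂φ Φ J ≡ I
    lift-exists : (I : V G) (f : E H) → s H f ≡ ∂φ Φ I →
                  ∃[ e ] (s G e ≡ I × φ Φ e ≡ f)
    lift-unique : (e₁ e₂ : E G) → s G e₁ ≡ s G e₂ → φ Φ e₁ ≡ φ Φ e₂ → e₁ ≡ e₂

data Over {G H : Graph} (Φ : Hom G H) :
     {I J : V G} {I' J' : V H} → Path G I J → Path H I' J' → Set where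
  over-nil  : {I : V G} {I' : V H} → ∂φ Φ I ≡ I' → Over Φ (nil I) (nil I')
  over-cons : {e : E G} {f : E H} {J : V G} {J' : V H}
              {γ : Path G (t G e) J} {δ : Path H (t H f) J'} →
              φ Φ e ≡ f → Over Φ γ δ → Over Φ (cons e γ) (cons f δ)

_·_↦_ : {G H : Graph} {Φ : Hom G H} {I' K : V H} →
        V G → Path H I' K → V G → Set
_·_↦_ {G} {Φ = Φ} I u J = Σ (Path G I J) (λ γ → Over Φ γ u)

Stable : {G H : Graph} (Φ : Hom G H) → V G → V G → Set
Stable {G} {H} Φ I₁ I₂ =
  ∂φ Φ I₁ ≡ ∂φ Φ I₂ ×
  ((K : V H) (u : Path H (∂φ Φ I₁) K) →
    ∃[ L ] Σ (Path H K L) λ v → ∃[ J ]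
      (_·_↦_ {Φ = Φ} I₁ (u ++ₚ v) J × _·_↦_ {Φ = Φ} I₂ (u ++ₚ v) J))

Synchronizing : {G H : Graph} (Φ : Hom G H) → Set
Synchronizing {G} Φ = (I₁ I₂ : V G) → ∂φ Φ I₁ ≡ ∂φ Φ I₂ → Stable Φ I₁ I₂

-- |(∂Φ)⁻¹(I) · u| = 1  (the fiber is nonempty for a right-resolver, so this
-- says all lifts of u from the fiber end at one common state J)
FiberSingleton : {G H : Graph} (Φ : Hom G H) (I : V H) {K : V H} →
                 Path H I K → Set
FiberSingleton {G} Φ I u =
  ∃[ J ] ((I' : V G) → ∂φ Φ I' ≡ I → _·_↦_ {Φ = Φ} I' u J)

_≤R_ : Graph → Graph → Set
H ≤R G = Σ (Hom G H) IsRightResolver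

-- Forward: starting from any word u that merges a part of the fiber over I into one
-- state J, a further state x of the fiber lands at x · u, which lies in the same fiber
-- as J and hence is stable with J; a word v merging the two extends u to a word merging
-- one more state.  Since G is finite, folding this over all states gives a word
-- collapsing the whole fiber.  Backward: to stabilise I₁, I₂ along u, follow u by a
-- word collapsing the fiber over the common endpoint of their lifts.
module Submission where

open import Defs
open import Data.Fin.Properties using (_≟_)
open import Data.List using (List; []; _∷_; allFin)
open import Data.List.Membership.Propositional using (_∈_)
open import Data.List.Membership.Propositional.Properties using (∈-allFin)
open import Data.List.Relation.Unary.Any using (here; there)
open import Data.Product using (Σ; ∃-syntax; _×_; _,_)
open import Function.Bundles using (_⇔_; mk⇔)
open import Relation.Binary.PropositionalEquality using (_≡_; refl; sym)
open import Relation.Nullary using (yes; no; contradiction)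

module _ {G H : Graph} (Φ : Hom G H) where

  _·_⇝_ : {A K : V H} → V G → Path H A K → V G → Set
  I · u ⇝ J = _·_↦_ {Φ = Φ} I u J

  Over-target : {I J : V G} {A K : V H} {γ : Path G I J} {u : Path H A K} →
                Over Φ γ u → ∂φ Φ J ≡ K
  Over-target (over-nil p)    = p
  Over-target (over-cons _ o) = Over-target o

  ⇝-target : {I J : V G} {A K : V H} {u : Path H A K} → I · u ⇝ J → ∂φ Φ J ≡ K
  ⇝-target (_ , o) = Over-target o

  ⇝-++ : {I J L : V G} {A B C : V H} {u : Path H A B} {v : Path H B C} →
         I · u ⇝ J → J · v ⇝ L → I · (u ++ₚ v) ⇝ L
  ⇝-++ (nil _ , over-nil refl) q = q
  ⇝-++ (cons e γ , over-cons p o) q with ⇝-++ (γ , o) q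
  ... | γ′ , o′ = cons e γ′ , over-cons p o′

  ⇝-exists : IsRightResolver Φ → {A K : V H} (I : V G) (u : Path H A K) →
             ∂φ Φ I ≡ A → ∃[ J ] I · u ⇝ J
  ⇝-exists rr I (nil _) refl = I , nil I , over-nil refl
  ⇝-exists rr I (cons f u) p with IsRightResolver.lift-exists rr I f (sym p)
  ... | e , refl , refl with ⇝-exists rr (t G e) u (sym (t-comm Φ e))
  ... | J , γ , o = J , cons e γ , over-cons refl o

  Stable⇒merging : {J₁ J₂ : V G} → Stable Φ J₁ J₂ →
                   ∃[ L ] Σ (Path H (∂φ Φ J₁) L) λ v → ∃[ J ] (J₁ · v ⇝ J × J₂ · v ⇝ J)
  Stable⇒merging (_ , stable) = stable _ (nil _)

  Merging : (I : V H) → List (V G) → Set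
  Merging I L = ∃[ K ] Σ (Path H I K) λ u → ∃[ J ] (∂φ Φ J ≡ K ×
                ((I′ : V G) → I′ ∈ L → ∂φ Φ I′ ≡ I → I′ · u ⇝ J))

  module _ (rr : IsRightResolver Φ) (sync : Synchronizing Φ) where

    merging-[] : (I : V H) → Merging I []
    merging-[] I with IsRightResolver.surjV rr I
    ... | J , p = I , nil I , J , p , λ _ ()

    merging-∷ : {I : V H} {L : List (V G)} (x : V G) → Merging I L → Merging I (x ∷ L)
    merging-∷ {I} x (K , u , J , J∈K , merges) with ∂φ Φ x ≟ I
    ... | no x∉I = K , u , J , J∈K , merges′
      where
      merges′ : (I′ : V G) → I′ ∈ x ∷ _ → ∂φ Φ I′ ≡ I → I′ · u ⇝ J
      merges′ _ (here refl) x∈I = contradiction x∈I x∉I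
      merges′ I′ (there I′∈L) I′∈I = merges I′ I′∈L I′∈I
    ... | yes x∈I with ⇝-exists rr x u x∈I
    ... | Jₓ , xu with ⇝-target xu
    ... | refl with Stable⇒merging (sync Jₓ J (sym J∈K))
    ... | M , v , J′ , Jₓv , Jv = M , u ++ₚ v , J′ , ⇝-target Jₓv , merges′
      where
      merges′ : (I′ : V G) → I′ ∈ x ∷ _ → ∂φ Φ I′ ≡ I → I′ · (u ++ₚ v) ⇝ J′
      merges′ _ (here refl) _ = ⇝-++ xu Jₓv
      merges′ I′ (there I′∈L) I′∈I = ⇝-++ (merges I′ I′∈L I′∈I) Jv

    merging : (I : V H) (L : List (V G)) → Merging I L
    merging I []      = merging-[] I
    merging I (x ∷ L) = merging-∷ x (merging I L)

    Synchronizing⇒FiberSingleton : (I : V H) → ∃[ K ] Σ (Path H I K) λ u → FiberSingleton Φ I u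
    Synchronizing⇒FiberSingleton I with merging I (allFin (nV G))
    ... | K , u , J , _ , merges = K , u , J , λ I′ → merges I′ (∈-allFin I′)

  FiberSingleton⇒Synchronizing : IsRightResolver Φ →
    ((I : V H) → ∃[ K ] Σ (Path H I K) λ u → FiberSingleton Φ I u) → Synchronizing Φ
  FiberSingleton⇒Synchronizing rr collapse I₁ I₂ I₁~I₂ = I₁~I₂ , stable
    where
    stable : (K : V H) (u : Path H (∂φ Φ I₁) K) →
             ∃[ L ] Σ (Path H K L) λ v → ∃[ J ] (I₁ · (u ++ₚ v) ⇝ J × I₂ · (u ++ₚ v) ⇝ J)
    stable K u with ⇝-exists rr I₁ u refl | ⇝-exists rr I₂ u (sym I₁~I₂) | collapse K
    ... | J₁ , I₁u | J₂ , I₂u | L , v , J , collapses =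
      L , v , J , ⇝-++ I₁u (collapses J₁ (⇝-target I₁u))
                , ⇝-++ I₂u (collapses J₂ (⇝-target I₂u))

proposition3p8 : (G H : Graph) → H ≤R G → (Φ : Hom G H) → IsRightResolver Φ →
    Synchronizing Φ ⇔ ((I : V H) → ∃[ K ] Σ (Path H I K) λ u → FiberSingleton Φ I u)
-- The hypothesis H ≤R G is redundant: Φ itself witnesses it.
proposition3p8 G H _ Φ rr =
  mk⇔ (Synchronizing⇒FiberSingleton Φ rr) (FiberSingleton⇒Synchronizing Φ rr)
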